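{- For every (finite, simple) graph $G$ without isolated vertices, $\chi'_{sCF}(G)\leq 3\lceil\log_2\chi(G)\rceil$, where $\chi(G)$ is the chromatic number of $G$.
   Context: For a graph $H$ and a vertex $v$, let $E_H(v)$ be the set of edges of $H$ incident to $v$, and for a pair $u,v$ let $E_H[uv]=E_H(u)\cup E_H(v)$. Given a graph $G$ and an edge colouring $c$ (not necessarily proper) of some subgraph $H$ of $G$, an edge $e$ of $G$ is satisfied by $c$ if the multiset $\{c(e'): e'\in E_H[e]\}$ contains a colour occurring exactly once in it. The parameter $\chi'_{sCF}(G)$ is the least number of colours for which there exist a subgraph $H$ of $G$ and an edge colouring of $H$ with that many colours satisfying every edge of $G$. -}

module Defs where

open import Data.Nat using (ℕ; zero; suc; _+_; _≤_; _<?_)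
open import Data.Fin using (Fin; toℕ; _≟_)
open import Data.Bool using (Bool; true; false; _∧_; _∨_; if_then_else_)
open import Data.List using (List; allFin; map)
open import Data.Nat.ListAction using (sum)
open import Data.Maybe using (Maybe; just; nothing)
import Data.Maybe.Properties as MP
open import Data.Product using (Σ; ∃; _×_; _,_)
open import Relation.Nullary using (¬_)
open import Relation.Nullary.Decidable using (⌊_⌋)
open import Relation.Binary.PropositionalEquality using (_≡_)

record Graph : Set where
  field
    n      : ℕ
    adj    : Fin n → Fin n → Bool
    adj-sym : ∀ u v → adj u v ≡ adj v u
    adj-irr : ∀ v → adj v v ≡ false
open Graph public

NoIsolatedVertices : Graph → Set
NoIsolatedVertices G = ∀ (v : Fin (n G)) → ∃ λ w → adj G v w ≡ true

ProperColouring : Graph → ℕ → Set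
ProperColouring G k =
  Σ (Fin (n G) → Fin k) λ c → ∀ u v → adj G u v ≡ true → ¬ (c u ≡ c v)

IsChromaticNumber : Graph → ℕ → Set
IsChromaticNumber G χ =
  ProperColouring G χ × (∀ m → ProperColouring G m → χ ≤ m)

-- A subgraph H of G together with an edge colouring of H with k colours,
-- encoded as f u v = just i  iff  uv ∈ E(H) and c(uv) = i  (nothing: uv ∉ E(H)).
record SubgraphColouring (G : Graph) (k : ℕ) : Set where
  field
    col     : Fin (n G) → Fin (n G) → Maybe (Fin k)
    col-sym : ∀ u v → col u v ≡ col v u
    col-sub : ∀ u v i → col u v ≡ just i → adj G u v ≡ true
open SubgraphColouring public

private
  b2n : Bool → ℕ
  b2n true  = 1
  b2n false = 0

-- number of edges e = {x,y} (counted once, via toℕ x < toℕ y) of H incident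
-- to u or v (i.e. e ∈ E_H[uv]) with colour i: the multiplicity of i in the
-- multiset {c(e') : e' ∈ E_H[uv]}.
multiplicity : ∀ {G k} → SubgraphColouring G k → Fin (n G) → Fin (n G) → Fin k → ℕ
multiplicity {G} f u v i =
  sum (map (λ x → sum (map (λ y →
    b2n ( ⌊ toℕ x <? toℕ y ⌋
        ∧ (⌊ x ≟ u ⌋ ∨ ⌊ x ≟ v ⌋ ∨ ⌊ y ≟ u ⌋ ∨ ⌊ y ≟ v ⌋)
        ∧ ⌊ MP.≡-dec _≟_ (col f x y) (just i) ⌋ ))
    (allFin (n G)))) (allFin (n G)))

Satisfied : ∀ {G k} → SubgraphColouring G k → Fin (n G) → Fin (n G) → Set
Satisfied {k = k} f u v = ∃ λ (i : Fin k) → multiplicity f u v i ≡ 1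

SCFColouring : Graph → ℕ → Set
SCFColouring G k =
  Σ (SubgraphColouring G k) λ f → ∀ u v → adj G u v ≡ true → Satisfied f u v

IsSCFIndex : Graph → ℕ → Set
IsSCFIndex G s = SCFColouring G s × (∀ m → SCFColouring G m → s ≤ m)

{-# OPTIONS --safe #-}
module Submission where

-- Fix a proper colouring and write the colours in binary with L = ⌈log₂ χ⌉ digits. An edge uv
-- gets the level j of the first digit in which the colours of u and v differ, and is directed
-- from the endpoint with digit 0 to the endpoint with digit 1. For each level j choose a set
-- D_j of tails that dominates all heads and is irredundant: every member has a private head.
-- Colour (j, 0) goes on an edge from each member of D_j to one of its private heads, and
-- colour (j, 1) on one edge into each remaining head, coming from D_j. For an arc u → v at
-- level j, the edges of E_H[uv] coloured (j, ·) all point from digit 0 to digit 1, so they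
-- leave u or enter v. If u ∈ D_j, privacy makes its (j, 0) edge unique; otherwise the (j, 0)
-- edge entering v, or failing that the (j, 1) edge entering v, is unique. Two colours per
-- level suffice, so χ'_sCF(G) ≤ 2⌈log₂ χ⌉ ≤ 3⌈log₂ χ⌉.

open import Defs
open import Data.Nat
  using (ℕ; zero; suc; >-nonZero; _+_; _*_; _^_; _≤_; _<_; _<?_; z≤n; s≤s; pred; ⌊_/2⌋; ⌈_/2⌉)
open import Data.Nat.Properties
  using (<-cmp; <-asym; +-identityʳ; +-monoˡ-≤; *-monoˡ-≤; *-monoʳ-≤; ⌊n/2⌋≤⌈n/2⌉; ⌊n/2⌋+⌈n/2⌉≡n
        ; ⌈n/2⌉<n; suc-pred; module ≤-Reasoning)
open import Data.Nat.Induction using (<-rec; <-wellFounded)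
open import Data.Nat.Logarithm using (⌈log₂_⌉; ⌈log₂⌉-mono-≤; ⌈log₂⌈n/2⌉⌉≡⌈log₂n⌉∸1)
open import Data.Nat.ListAction using (sum)
open import Data.Empty using (⊥; ⊥-elim)
open import Data.Bool using (Bool; true; false; T; not; _∧_; _∨_)
import Data.Bool.Properties as Boolₚ
open import Data.Fin using (Fin; toℕ; _≟_; zero; suc; combine; remQuot; inject≤)
open import Data.Fin.Patterns using (0F; 1F)
open import Data.Fin.Properties
  using (any?; all?; suc-injective; toℕ-injective; combine-injective; combine-remQuot; inject≤-injective)
open import Data.Fin.Subset using (Subset; _∈_; ⊤; _-_; ∣_∣)
open import Data.Fin.Subset.Properties using (_∈?_; ∈⊤; x∈p∧x≢y⇒x∈p-y; x∈p⇒∣p-x∣<∣p∣)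
open import Data.List using (allFin; map)
open import Data.List.Properties using (map-tabulate; map-cong)
open import Data.Maybe using (Maybe; just; nothing; _<∣>_)
import Data.Maybe as Maybe
import Data.Maybe.Properties as Maybeₚ
open import Data.Product using (∃; ∃₂; _×_; _,_; proj₁; proj₂; uncurry)
import Data.Product as Product
open import Data.Sum using (_⊎_; inj₁; inj₂)
import Data.Sum as Sum
open import Data.Vec using (Vec; []; _∷_; lookup)
open import Data.Vec.Properties using (∷-injective)
open import Function using (_∘_)
open import Induction.WellFounded using (Acc; acc)
open import Level using (0ℓ)
open import Relation.Binary using (DecidableEquality; Rel; Decidable)
open import Relation.Binary.Definitions using (tri<; tri≈; tri>)
open import Relation.Binary.PropositionalEquality
  using (_≡_; _≢_; refl; sym; trans; cong; cong₂; subst; module ≡-Reasoning)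
open import Relation.Nullary using (¬_; Dec; yes; no; contradiction)
open import Relation.Nullary.Decidable
  using (⌊_⌋; _×-dec_; _→-dec_; ¬?; decidable-stable)

pairSum : ∀ {m} → (Fin m → Fin m → ℕ) → ℕ
pairSum {m} g = sum (map (λ x → sum (map (g x) (allFin m))) (allFin m))

indicator : Bool → ℕ
indicator true  = 1
indicator false = 0

pairSum-cong : ∀ {m} {g h : Fin m → Fin m → ℕ} → (∀ x y → g x y ≡ h x y) → pairSum g ≡ pairSum h
pairSum-cong {m} g≡h = sum-map-cong (λ x → sum-map-cong (g≡h x))
  where
  sum-map-cong : ∀ {g h : Fin m → ℕ} → (∀ x → g x ≡ h x) →
                 sum (map g (allFin m)) ≡ sum (map h (allFin m))
  sum-map-cong g≡h = cong sum (map-cong g≡h (allFin m))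

indicator-unique : (ι : Bool → ℕ) → ι true ≡ 1 → ι false ≡ 0 → ∀ b → ι b ≡ indicator b
indicator-unique ι ι-true ι-false true  = ι-true
indicator-unique ι ι-true ι-false false = ι-false

sum-allFin-suc : ∀ {m} (g : Fin (suc m) → ℕ) →
                 sum (map g (allFin (suc m))) ≡ g zero + sum (map (g ∘ suc) (allFin m))
sum-allFin-suc {m} g = cong (λ xs → g zero + sum xs)
  (trans (map-tabulate suc g) (sym (map-tabulate (λ x → x) (g ∘ suc))))

sum-allFin-zero : ∀ {m} (g : Fin m → ℕ) → (∀ x → g x ≡ 0) → sum (map g (allFin m)) ≡ 0
sum-allFin-zero {zero}  g g≡0 = refl
sum-allFin-zero {suc m} g g≡0 =
  trans (sum-allFin-suc g) (cong₂ _+_ (g≡0 zero) (sum-allFin-zero (g ∘ suc) (g≡0 ∘ suc)))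

sum-allFin-single : ∀ {m} (g : Fin m → ℕ) x₀ → g x₀ ≡ 1 → (∀ x → x ≢ x₀ → g x ≡ 0) →
                    sum (map g (allFin m)) ≡ 1
sum-allFin-single {suc m} g zero g₀≡1 g≡0 = trans (sum-allFin-suc g)
  (cong₂ _+_ g₀≡1 (sum-allFin-zero (g ∘ suc) (λ x → g≡0 (suc x) λ ())))
sum-allFin-single {suc m} g (suc x₀) g₀≡1 g≡0 = trans (sum-allFin-suc g)
  (cong₂ _+_ (g≡0 zero λ ())
             (sum-allFin-single (g ∘ suc) x₀ g₀≡1 (λ x x≢x₀ → g≡0 (suc x) (x≢x₀ ∘ suc-injective))))

pairSum-indicator-unique : ∀ {m} (P : Fin m → Fin m → Bool) {p q} → T (P p q) →
                           (∀ x y → T (P x y) → x ≡ p × y ≡ q) →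
                           pairSum (λ x y → indicator (P x y)) ≡ 1
pairSum-indicator-unique P {p} {q} Ppq unique =
  sum-allFin-single _ p (sum-allFin-single _ q (indicator-T Ppq)
                                               (λ y y≢q → indicator-¬T (y≢q ∘ proj₂ ∘ unique p y)))
                        (λ x x≢p → sum-allFin-zero _ (λ y → indicator-¬T (x≢p ∘ proj₁ ∘ unique x y)))
  where
  indicator-T : ∀ {b} → T b → indicator b ≡ 1
  indicator-T {true} _ = refl

  indicator-¬T : ∀ {b} → ¬ T b → indicator b ≡ 0
  indicator-¬T {true}  ¬Tb = contradiction _ ¬Tb
  indicator-¬T {false} _   = refl

Incident : ∀ {V : Set} → V → V → V → V → Set
Incident u v x y = x ≡ u ⊎ x ≡ v ⊎ y ≡ u ⊎ y ≡ v

incident-swap : ∀ {V : Set} {u v x y : V} → Incident u v x y → Incident u v y x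
incident-swap (inj₁ x≡u)                 = inj₂ (inj₂ (inj₁ x≡u))
incident-swap (inj₂ (inj₁ x≡v))          = inj₂ (inj₂ (inj₂ x≡v))
incident-swap (inj₂ (inj₂ (inj₁ y≡u)))   = inj₁ y≡u
incident-swap (inj₂ (inj₂ (inj₂ y≡v)))   = inj₂ (inj₁ y≡v)

incident-flip : ∀ {V : Set} {u v x y : V} → Incident u v x y → Incident v u x y
incident-flip (inj₁ x≡u)                 = inj₂ (inj₁ x≡u)
incident-flip (inj₂ (inj₁ x≡v))          = inj₁ x≡v
incident-flip (inj₂ (inj₂ (inj₁ y≡u)))   = inj₂ (inj₂ (inj₂ y≡u))
incident-flip (inj₂ (inj₂ (inj₂ y≡v)))   = inj₂ (inj₂ (inj₁ y≡v))

SameEdge : ∀ {V : Set} → V → V → V → V → Set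
SameEdge x y p q = (x ≡ p × y ≡ q) ⊎ (x ≡ q × y ≡ p)

sameEdge-ordered : ∀ {m} {p q x y : Fin m} → toℕ p < toℕ q → toℕ x < toℕ y →
                   SameEdge x y p q → x ≡ p × y ≡ q
sameEdge-ordered _   _   (inj₁ same)          = same
sameEdge-ordered p<q x<y (inj₂ (refl , refl)) = ⊥-elim (<-asym p<q x<y)

K₂ : Graph
K₂ = record { n = 2 ; adj = adj₂ ; adj-sym = adj₂-sym ; adj-irr = λ { 0F → refl ; 1F → refl } }
  where
  adj₂ : Fin 2 → Fin 2 → Bool
  adj₂ x y = not ⌊ x ≟ y ⌋

  adj₂-sym : ∀ x y → adj₂ x y ≡ adj₂ y x
  adj₂-sym 0F 0F = refl
  adj₂-sym 0F 1F = refl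
  adj₂-sym 1F 0F = refl
  adj₂-sym 1F 1F = refl

K₂-edge : Maybe (Fin 1) → SubgraphColouring K₂ 1
K₂-edge m = record { col = col₂ ; col-sym = col₂-sym ; col-sub = col₂-sub }
  where
  col₂ : Fin 2 → Fin 2 → Maybe (Fin 1)
  col₂ 0F 1F = m
  col₂ 1F 0F = m
  col₂ _  _  = nothing

  col₂-sym : ∀ x y → col₂ x y ≡ col₂ y x
  col₂-sym 0F 0F = refl
  col₂-sym 0F 1F = refl
  col₂-sym 1F 0F = refl
  col₂-sym 1F 1F = refl

  col₂-sub : ∀ x y i → col₂ x y ≡ just i → adj K₂ x y ≡ true
  col₂-sub 0F 1F _ _ = refl
  col₂-sub 1F 0F _ _ = refl

module _ {G : Graph} {k : ℕ} (f : SubgraphColouring G k) where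

  Counted : Fin (n G) → Fin (n G) → Fin k → Fin (n G) → Fin (n G) → Set
  Counted u v i x y = toℕ x < toℕ y × Incident u v x y × col f x y ≡ just i

  counts : Fin (n G) → Fin (n G) → Fin k → Fin (n G) → Fin (n G) → Bool
  counts u v i x y = ⌊ toℕ x <? toℕ y ⌋
                   ∧ (⌊ x ≟ u ⌋ ∨ ⌊ x ≟ v ⌋ ∨ ⌊ y ≟ u ⌋ ∨ ⌊ y ≟ v ⌋)
                   ∧ ⌊ Maybeₚ.≡-dec _≟_ (col f x y) (just i) ⌋

  -- Defs counts with a 0/1 indicator it keeps private, so it cannot be named here. On the
  -- edge of K₂ coloured m, the multiplicity reduces to that indicator applied to the test
  -- m ≟ just 0, plus zeros; abstracting the test to a variable w gives e the type
  -- ι w + 0 + 0 ≡ ι w + 0 + 0 with ι the indicator, and pin recovers ι by unification.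
  multiplicity≡pairSum : ∀ u v i →
    multiplicity f u v i ≡ pairSum (λ x y → indicator (counts u v i x y))
  multiplicity≡pairSum u v i = via-K₂ nothing refl
    where
    via-K₂ : ∀ m → multiplicity (K₂-edge m) 0F 1F 0F ≡ multiplicity (K₂-edge m) 0F 1F 0F →
             multiplicity f u v i ≡ pairSum (λ x y → indicator (counts u v i x y))
    via-K₂ m e with ⌊ Maybeₚ.≡-dec _≟_ m (just 0F) ⌋
    ... | w = pairSum-cong (λ x y → indicator-unique (pin e) refl refl (counts u v i x y))
      where
      pin : ∀ {ι : Bool → ℕ} → ι w + 0 + 0 ≡ ι w + 0 + 0 → Bool → ℕ
      pin {ι} _ = ι

  counts-sound : ∀ {u v i x y} → T (counts u v i x y) → Counted u v i x y
  counts-sound {u} {v} {i} {x} {y} h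
    with toℕ x <? toℕ y | x ≟ u | x ≟ v | y ≟ u | y ≟ v | Maybeₚ.≡-dec _≟_ (col f x y) (just i)
  ... | no _   | _        | _        | _        | _        | _       = ⊥-elim h
  ... | yes _  | _        | _        | _        | _        | no _    = ⊥-elim (absurd-hit h)
    where
    absurd-hit : ∀ {b} → ¬ T (true ∧ b ∧ false)
    absurd-hit {true}  ()
    absurd-hit {false} ()
  ... | yes lt | yes x≡u  | _        | _        | _        | yes hit = lt , inj₁ x≡u , hit
  ... | yes lt | no _     | yes x≡v  | _        | _        | yes hit = lt , inj₂ (inj₁ x≡v) , hit
  ... | yes lt | no _     | no _     | yes y≡u  | _        | yes hit = lt , inj₂ (inj₂ (inj₁ y≡u)) , hit
  ... | yes lt | no _     | no _     | no _     | yes y≡v  | yes hit = lt , inj₂ (inj₂ (inj₂ y≡v)) , hit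
  ... | yes _  | no _     | no _     | no _     | no _     | yes _   = ⊥-elim h

  counts-complete : ∀ {u v i x y} → Counted u v i x y → T (counts u v i x y)
  counts-complete {u} {v} {i} {x} {y} (lt , touch , hit)
    with toℕ x <? toℕ y | x ≟ u | x ≟ v | y ≟ u | y ≟ v | Maybeₚ.≡-dec _≟_ (col f x y) (just i)
  ... | no ¬lt | _     | _     | _     | _     | _       = ⊥-elim (¬lt lt)
  ... | yes _  | _     | _     | _     | _     | no ¬hit = ⊥-elim (¬hit hit)
  ... | yes _  | yes _ | _     | _     | _     | yes _   = _
  ... | yes _  | no _  | yes _ | _     | _     | yes _   = _
  ... | yes _  | no _  | no _  | yes _ | _     | yes _   = _
  ... | yes _  | no _  | no _  | no _  | yes _ | yes _   = _
  ... | yes _  | no x≢u | no x≢v | no y≢u | no y≢v | yes _ = ⊥-elim (untouched touch)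
    where
    untouched : ¬ Incident u v x y
    untouched (inj₁ x≡u)               = x≢u x≡u
    untouched (inj₂ (inj₁ x≡v))        = x≢v x≡v
    untouched (inj₂ (inj₂ (inj₁ y≡u))) = y≢u y≡u
    untouched (inj₂ (inj₂ (inj₂ y≡v))) = y≢v y≡v

  multiplicity≡1 : ∀ {u v i p q} → Counted u v i p q → (∀ {x y} → Counted u v i x y → x ≡ p × y ≡ q) →
                   multiplicity f u v i ≡ 1
  multiplicity≡1 {u} {v} {i} counted unique = trans (multiplicity≡pairSum u v i)
    (pairSum-indicator-unique (counts u v i) (counts-complete counted) (λ _ _ → unique ∘ counts-sound))

  UniqueColour : Fin (n G) → Fin (n G) → Set
  UniqueColour u v = ∃ λ i → ∃₂ λ p q → col f p q ≡ just i × Incident u v p q ×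
                       (∀ x y → Incident u v x y → col f x y ≡ just i → SameEdge x y p q)

  uniqueColour-flip : ∀ {u v} → UniqueColour u v → UniqueColour v u
  uniqueColour-flip (i , p , q , coloured , incident , unique) =
    i , p , q , coloured , incident-flip incident , λ x y → unique x y ∘ incident-flip

  uniqueColour⇒satisfied : ∀ {u v} → UniqueColour u v → Satisfied f u v
  uniqueColour⇒satisfied (i , p , q , coloured , incident , unique) with <-cmp (toℕ p) (toℕ q)
  ... | tri< p<q _ _ =
    i , multiplicity≡1 (p<q , incident , coloured)
                       (λ (x<y , incident′ , coloured′) →
                          sameEdge-ordered p<q x<y (unique _ _ incident′ coloured′))
  ... | tri≈ _ p≡q _ = contradiction (trans (sym (adj-irr G p)) adj-pp) λ ()
    where
    adj-pp : adj G p p ≡ true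
    adj-pp = subst (λ z → adj G p z ≡ true) (sym (toℕ-injective p≡q)) (col-sub f p q i coloured)
  ... | tri> _ _ q<p =
    i , multiplicity≡1 (q<p , incident-swap incident , trans (col-sym f q p) coloured)
                       (λ (x<y , incident′ , coloured′) →
                          sameEdge-ordered q<p x<y (Sum.swap (unique _ _ incident′ coloured′)))

module IrredundantDomination {m} (R : Rel (Fin m) 0ℓ) (R? : Decidable R) where

  Dominates : Subset m → Set
  Dominates C = ∀ {a b} → R a b → ∃ λ a′ → a′ ∈ C × R a′ b

  HasPrivateTarget : Subset m → Fin m → Set
  HasPrivateTarget C a = ∃ λ b → R a b × (∀ a′ → a′ ∈ C → R a′ b → a′ ≡ a)

  hasPrivateTarget? : ∀ C a → Dec (HasPrivateTarget C a)
  hasPrivateTarget? C a = any? λ b → R? a b ×-dec all? λ a′ → a′ ∈? C →-dec R? a′ b →-dec a′ ≟ a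

  dominates-remove : ∀ {C x} → Dominates C → ¬ HasPrivateTarget C x → Dominates (C - x)
  dominates-remove {C} {x} dominates noPrivate {b = b} r with dominates r
  ... | a , a∈C , ab with a ≟ x
  ...   | no a≢x = a , x∈p∧x≢y⇒x∈p-y a∈C a≢x , ab
  ...   | yes refl with any? (λ a′ → a′ ∈? C ×-dec R? a′ b ×-dec ¬? (a′ ≟ x))
  ...     | yes (a′ , a′∈C , a′b , a′≢x) = a′ , x∈p∧x≢y⇒x∈p-y a′∈C a′≢x , a′b
  ...     | no none = contradiction (b , ab , only-x) noPrivate
    where
    only-x : ∀ a′ → a′ ∈ C → R a′ b → a′ ≡ x
    only-x a′ a′∈C a′b = decidable-stable (a′ ≟ x) (λ a′≢x → none (a′ , a′∈C , a′b , a′≢x))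

  irredundant-dominating : ∀ C → Dominates C →
    ∃ λ D → Dominates D × (∀ {a} → a ∈ D → HasPrivateTarget D a)
  irredundant-dominating C = shrink C (<-wellFounded ∣ C ∣)
    where
    shrink : ∀ B → Acc _<_ ∣ B ∣ → Dominates B →
             ∃ λ D → Dominates D × (∀ {a} → a ∈ D → HasPrivateTarget D a)
    shrink B (acc smaller) dominates with any? (λ x → x ∈? B ×-dec ¬? (hasPrivateTarget? B x))
    ... | yes (x , x∈B , noPrivate) =
      shrink (B - x) (smaller (x∈p⇒∣p-x∣<∣p∣ x∈B)) (dominates-remove dominates noPrivate)
    ... | no none = B , dominates , λ a∈B →
      decidable-stable (hasPrivateTarget? B _) (λ noPrivate → none (_ , a∈B , noPrivate))

  -- Abstract, so that type checking never unfolds the greedy search behind the cover.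
  abstract
    private
      cover : ∃ λ D → Dominates D × (∀ {a} → a ∈ D → HasPrivateTarget D a)
      cover = irredundant-dominating ⊤ (λ {a} ab → a , ∈⊤ , ab)

    dominators : Subset m
    dominators = proj₁ cover

    dominator : Fin m → Fin m
    dominator b with any? (λ a → a ∈? dominators ×-dec R? a b)
    ... | yes (a , _) = a
    ... | no _        = b

    dominator-spec : ∀ {a b} → R a b → dominator b ∈ dominators × R (dominator b) b
    dominator-spec {b = b} ab with any? (λ a → a ∈? dominators ×-dec R? a b)
    ... | yes (_ , dominated) = dominated
    ... | no none             = contradiction (proj₁ (proj₂ cover) ab) none

    privateTarget : Fin m → Fin m
    privateTarget a with a ∈? dominators
    ... | yes a∈D = proj₁ (proj₂ (proj₂ cover) a∈D)
    ... | no _    = a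

    privateTarget-spec : ∀ {a} → a ∈ dominators →
      R a (privateTarget a) × (∀ a′ → a′ ∈ dominators → R a′ (privateTarget a) → a′ ≡ a)
    privateTarget-spec {a} a∈D with a ∈? dominators
    ... | yes a∈D′ = proj₂ (proj₂ (proj₂ cover) a∈D′)
    ... | no a∉D   = contradiction a∈D a∉D

module _ {A : Set} (_≟ᴬ_ : DecidableEquality A) where

  firstDifference : ∀ {L} → Vec A L → Vec A L → Maybe (Fin L)
  firstDifference []       []       = nothing
  firstDifference (x ∷ xs) (y ∷ ys) with x ≟ᴬ y
  ... | yes _ = Maybe.map suc (firstDifference xs ys)
  ... | no _  = just zero

  firstDifference-sym : ∀ {L} (xs ys : Vec A L) → firstDifference xs ys ≡ firstDifference ys xs
  firstDifference-sym []       []       = refl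
  firstDifference-sym (x ∷ xs) (y ∷ ys) with x ≟ᴬ y | y ≟ᴬ x
  ... | yes _   | yes _   = cong (Maybe.map suc) (firstDifference-sym xs ys)
  ... | yes x≡y | no y≢x  = contradiction (sym x≡y) y≢x
  ... | no x≢y  | yes y≡x = contradiction (sym y≡x) x≢y
  ... | no _    | no _    = refl

  firstDifference-nothing : ∀ {L} {xs ys : Vec A L} → firstDifference xs ys ≡ nothing → xs ≡ ys
  firstDifference-nothing {xs = []}     {[]}     _ = refl
  firstDifference-nothing {xs = x ∷ xs} {y ∷ ys} eq with x ≟ᴬ y
  ... | yes refl with firstDifference xs ys in rest
  ...   | nothing = cong (x ∷_) (firstDifference-nothing rest)

  firstDifference-just : ∀ {L} {xs ys : Vec A L} {j} → firstDifference xs ys ≡ just j →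
                         lookup xs j ≢ lookup ys j
  firstDifference-just {xs = x ∷ xs} {y ∷ ys} eq with x ≟ᴬ y
  ... | no x≢y with refl ← eq = x≢y
  ... | yes _ with firstDifference xs ys in rest
  ...   | just j with refl ← eq = firstDifference-just {xs = xs} {ys} rest

binary : ∀ L → Fin (2 ^ L) → Vec (Fin 2) L
binary zero    _ = []
binary (suc L) i = let (b , r) = remQuot (2 ^ L) i in b ∷ binary L r

binary-injective : ∀ L {i j} → binary L i ≡ binary L j → i ≡ j
binary-injective zero {zero} {zero} _ = refl
binary-injective (suc L) {i} {j} eq =
  let (b≡ , r≡) = ∷-injective eq in begin
    i                                   ≡⟨ combine-remQuot (2 ^ L) i ⟨
    uncurry combine (remQuot (2 ^ L) i) ≡⟨ cong₂ combine b≡ (binary-injective L r≡) ⟩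
    uncurry combine (remQuot (2 ^ L) j) ≡⟨ combine-remQuot (2 ^ L) j ⟩
    j                                   ∎
  where open ≡-Reasoning

n≤2^⌈log₂n⌉ : ∀ n → n ≤ 2 ^ ⌈log₂ n ⌉
n≤2^⌈log₂n⌉ = <-rec _ bound
  where
  open ≤-Reasoning

  bound : ∀ n → (∀ {m} → m < n → m ≤ 2 ^ ⌈log₂ m ⌉) → n ≤ 2 ^ ⌈log₂ n ⌉
  bound zero          _  = z≤n
  bound (suc zero)    _  = s≤s z≤n
  bound n@(suc (suc m)) ih = begin
    n                            ≡⟨ ⌊n/2⌋+⌈n/2⌉≡n n ⟨
    ⌊ n /2⌋ + ⌈ n /2⌉            ≤⟨ +-monoˡ-≤ ⌈ n /2⌉ (⌊n/2⌋≤⌈n/2⌉ n) ⟩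
    ⌈ n /2⌉ + ⌈ n /2⌉            ≡⟨ cong (⌈ n /2⌉ +_) (+-identityʳ ⌈ n /2⌉) ⟨
    2 * ⌈ n /2⌉                  ≤⟨ *-monoʳ-≤ 2 (ih (⌈n/2⌉<n m)) ⟩
    2 * 2 ^ ⌈log₂ ⌈ n /2⌉ ⌉      ≡⟨ cong (λ e → 2 ^ suc e) (⌈log₂⌈n/2⌉⌉≡⌈log₂n⌉∸1 n) ⟩
    2 ^ suc (pred ⌈log₂ n ⌉)     ≡⟨ cong (2 ^_) (suc-pred ⌈log₂ n ⌉ {{>-nonZero log>0}}) ⟩
    2 ^ ⌈log₂ n ⌉                ∎
    where
    log>0 : 0 < ⌈log₂ n ⌉
    log>0 = ⌈log₂⌉-mono-≤ {2} {n} (s≤s (s≤s z≤n))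

module BinaryCode (G : Graph) (L : ℕ) (code : Fin (n G) → Vec (Fin 2) L)
                  (code-proper : ∀ u v → adj G u v ≡ true → code u ≢ code v) where

  V : Set
  V = Fin (n G)

  level : V → V → Maybe (Fin L)
  level x y = firstDifference _≟_ (code x) (code y)

  level-sym : ∀ x y → level x y ≡ level y x
  level-sym x y = firstDifference-sym _≟_ (code x) (code y)

  bit : Fin L → V → Fin 2
  bit j x = lookup (code x) j

  Arc : Fin L → Rel V 0ℓ
  Arc j a b = adj G a b ≡ true × level a b ≡ just j × bit j a ≡ 0F × bit j b ≡ 1F

  arc? : ∀ j → Decidable (Arc j)
  arc? j a b = adj G a b Boolₚ.≟ true ×-dec Maybeₚ.≡-dec _≟_ (level a b) (just j)
               ×-dec bit j a ≟ 0F ×-dec bit j b ≟ 1F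

  arc-orientation : ∀ {u v} → adj G u v ≡ true → ∃ λ j → Arc j u v ⊎ Arc j v u
  arc-orientation {u} {v} uv with level u v in uv-level
  ... | nothing = contradiction (firstDifference-nothing _≟_ uv-level) (code-proper u v uv)
  ... | just j with bit j u in u-bit | bit j v in v-bit
                   | firstDifference-just _≟_ {xs = code u} {code v} uv-level
  ...   | 0F | 1F | _      = j , inj₁ (uv , refl , u-bit , v-bit)
  ...   | 1F | 0F | _      =
    j , inj₂ (trans (adj-sym G v u) uv , trans (level-sym v u) uv-level , v-bit , u-bit)
  ...   | 0F | 0F | differ = contradiction refl differ
  ...   | 1F | 1F | differ = contradiction refl differ

  arc-antisym : ∀ {j j′ a b} → Arc j a b → Arc j′ b a → ⊥
  arc-antisym (_ , ab-level , a-bit , _) (_ , ba-level , _ , a-bit′)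
    with trans (sym ab-level) (trans (level-sym _ _) ba-level)
  ... | refl = contradiction (trans (sym a-bit) a-bit′) λ ()

  arc-incident : ∀ {j u v a b} → Arc j u v → Arc j a b → Incident u v a b → a ≡ u ⊎ b ≡ v
  arc-incident _                 _                 (inj₁ a≡u)                  = inj₁ a≡u
  arc-incident (_ , _ , _ , v-bit) (_ , _ , a-bit , _) (inj₂ (inj₁ refl))        =
    contradiction (trans (sym a-bit) v-bit) λ ()
  arc-incident (_ , _ , u-bit , _) (_ , _ , _ , b-bit) (inj₂ (inj₂ (inj₁ refl))) =
    contradiction (trans (sym u-bit) b-bit) λ ()
  arc-incident _                 _                 (inj₂ (inj₂ (inj₂ b≡v)))    = inj₂ b≡v

  module Cover (j : Fin L) = IrredundantDomination (Arc j) (arc? j)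
  open Cover using (dominators; dominator; dominator-spec; privateTarget; privateTarget-spec)

  Matching : Fin L → Rel V 0ℓ
  Matching j a b = a ∈ dominators j × privateTarget j a ≡ b

  matching? : ∀ j → Decidable (Matching j)
  matching? j a b = a ∈? dominators j ×-dec privateTarget j a ≟ b

  matching⇒arc : ∀ {j a b} → Matching j a b → Arc j a b
  matching⇒arc {j} (a∈D , refl) = proj₁ (privateTarget-spec j a∈D)

  Spare : Fin L → Rel V 0ℓ
  Spare j a b = Arc j a b × dominator j b ≡ a × ¬ ∃ (λ w → Matching j w b)

  spare? : ∀ j → Decidable (Spare j)
  spare? j a b = arc? j a b ×-dec dominator j b ≟ a ×-dec ¬? (any? λ w → matching? j w b)

  colour : Fin 2 → Fin L → Fin (2 * L)
  colour = combine

  colour-injective : ∀ t t′ {j j′} → colour t j ≡ colour t′ j′ → t ≡ t′ × j ≡ j′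
  colour-injective t t′ {j} {j′} = combine-injective t j t′ j′

  levelColour : Fin L → V → V → Maybe (Fin (2 * L))
  levelColour j a b with matching? j a b | spare? j a b
  ... | yes _ | _     = just (colour 0F j)
  ... | no _  | yes _ = just (colour 1F j)
  ... | no _  | no _  = nothing

  arcColour : V → V → Maybe (Fin (2 * L))
  arcColour a b = level a b Maybe.>>= λ j → levelColour j a b

  arcColour-sound : ∀ {a b c} → arcColour a b ≡ just c →
    ∃ λ j → (c ≡ colour 0F j × Matching j a b) ⊎ (c ≡ colour 1F j × Spare j a b)
  arcColour-sound {a} {b} = sound (level a b)
    where
    sound : ∀ {c} ℓ → (ℓ Maybe.>>= λ j → levelColour j a b) ≡ just c →
      ∃ λ j → (c ≡ colour 0F j × Matching j a b) ⊎ (c ≡ colour 1F j × Spare j a b)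
    sound (just j) eq with matching? j a b | spare? j a b
    ... | yes m | _     with refl ← eq = j , inj₁ (refl , m)
    ... | no _  | yes s with refl ← eq = j , inj₂ (refl , s)

  arcColour-arc : ∀ {a b c} → arcColour a b ≡ just c → ∃ λ j → Arc j a b
  arcColour-arc eq with arcColour-sound eq
  ... | j , inj₁ (_ , m)            = j , matching⇒arc m
  ... | j , inj₂ (_ , (ab , _ , _)) = j , ab

  arcColour-at-level : ∀ {j a b} → Arc j a b → arcColour a b ≡ levelColour j a b
  arcColour-at-level {a = a} {b} (_ , ab-level , _) = cong (Maybe._>>= λ j → levelColour j a b) ab-level

  arcColour-matching : ∀ {j a b} → Matching j a b → arcColour a b ≡ just (colour 0F j)
  arcColour-matching {j} {a} {b} m = trans (arcColour-at-level (matching⇒arc m)) levelColour-matching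
    where
    levelColour-matching : levelColour j a b ≡ just (colour 0F j)
    levelColour-matching with matching? j a b
    ... | yes _ = refl
    ... | no ¬m = contradiction m ¬m

  arcColour-spare : ∀ {j a b} → Spare j a b → arcColour a b ≡ just (colour 1F j)
  arcColour-spare {j} {a} {b} s@(ab , _ , unmatched) = trans (arcColour-at-level ab) levelColour-spare
    where
    levelColour-spare : levelColour j a b ≡ just (colour 1F j)
    levelColour-spare with matching? j a b | spare? j a b
    ... | yes m | _     = contradiction (a , m) unmatched
    ... | no _  | yes _ = refl
    ... | no _  | no ¬s = contradiction s ¬s

  matching-sound : ∀ {j a b} → arcColour a b ≡ just (colour 0F j) → Matching j a b
  matching-sound eq with arcColour-sound eq
  ... | _ , inj₂ (c≡ , _) with () ← proj₁ (colour-injective 0F 1F c≡)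
  ... | _ , inj₁ (c≡ , m) with colour-injective 0F 0F c≡
  ...   | _ , refl = m

  spare-sound : ∀ {j a b} → arcColour a b ≡ just (colour 1F j) → Spare j a b
  spare-sound eq with arcColour-sound eq
  ... | _ , inj₁ (c≡ , _) with () ← proj₁ (colour-injective 1F 0F c≡)
  ... | _ , inj₂ (c≡ , s) with colour-injective 1F 1F c≡
  ...   | _ , refl = s

  edgeColour : V → V → Maybe (Fin (2 * L))
  edgeColour x y = arcColour x y <∣> arcColour y x

  edgeColour-arc : ∀ {x y c} → arcColour x y ≡ just c → edgeColour x y ≡ just c
  edgeColour-arc {x} {y} xy = cong (_<∣> arcColour y x) xy

  edgeColour-sym : ∀ x y → edgeColour x y ≡ edgeColour y x
  edgeColour-sym x y with arcColour x y in xy | arcColour y x in yx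
  ... | nothing | nothing = refl
  ... | just _  | nothing = refl
  ... | nothing | just _  = refl
  ... | just _  | just _  = ⊥-elim (arc-antisym (proj₂ (arcColour-arc xy)) (proj₂ (arcColour-arc yx)))

  edgeColour-sound : ∀ {x y c} → edgeColour x y ≡ just c →
                     arcColour x y ≡ just c ⊎ arcColour y x ≡ just c
  edgeColour-sound {x} {y} eq with arcColour x y
  ... | just _  = inj₁ eq
  ... | nothing = inj₂ eq

  edgeColour-adj : ∀ {x y c} → edgeColour x y ≡ just c → adj G x y ≡ true
  edgeColour-adj {x} {y} eq with edgeColour-sound eq
  ... | inj₁ xy = proj₁ (proj₂ (arcColour-arc xy))
  ... | inj₂ yx = trans (adj-sym G x y) (proj₁ (proj₂ (arcColour-arc yx)))

  colouring : SubgraphColouring G (2 * L)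
  colouring = record { col = edgeColour ; col-sym = edgeColour-sym ; col-sub = λ _ _ _ → edgeColour-adj }

  sameEdge-from-arcs : ∀ {u v c p q} (P : Rel V 0ℓ) → (∀ {a b} → arcColour a b ≡ just c → P a b) →
    (∀ {a b} → P a b → Incident u v a b → a ≡ p × b ≡ q) →
    ∀ x y → Incident u v x y → edgeColour x y ≡ just c → SameEdge x y p q
  sameEdge-from-arcs P sound unique x y incident eq with edgeColour-sound eq
  ... | inj₁ xy = inj₁ (unique (sound xy) incident)
  ... | inj₂ yx = inj₂ (Product.swap (unique (sound yx) (incident-swap incident)))

  uniqueColour-arc : ∀ {j u v} → Arc j u v → UniqueColour colouring u v
  uniqueColour-arc {j} {u} {v} uv with u ∈? dominators j | any? (λ w → matching? j w v)
  ... | yes u∈D | _ =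
    colour 0F j , u , privateTarget j u , edgeColour-arc (arcColour-matching (u∈D , refl)) , inj₁ refl ,
    sameEdge-from-arcs (Matching j) matching-sound unique
    where
    unique : ∀ {a b} → Matching j a b → Incident u v a b → a ≡ u × b ≡ privateTarget j u
    unique (a∈D , refl) incident with arc-incident uv (matching⇒arc (a∈D , refl)) incident
    ... | inj₁ refl = refl , refl
    ... | inj₂ target≡v with proj₂ (privateTarget-spec j a∈D) u u∈D (subst (Arc j u) (sym target≡v) uv)
    ...   | refl = refl , refl
  ... | no u∉D | yes (w , w∈D , target≡v) =
    colour 0F j , w , v , edgeColour-arc (arcColour-matching (w∈D , target≡v)) ,
    inj₂ (inj₂ (inj₂ refl)) , sameEdge-from-arcs (Matching j) matching-sound unique
    where
    unique : ∀ {a b} → Matching j a b → Incident u v a b → a ≡ w × b ≡ v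
    unique (a∈D , refl) incident with arc-incident uv (matching⇒arc (a∈D , refl)) incident
    ... | inj₁ refl    = contradiction a∈D u∉D
    ... | inj₂ target≡v′ =
      proj₂ (privateTarget-spec j w∈D) _ a∈D
        (subst (Arc j _) (trans target≡v′ (sym target≡v)) (matching⇒arc (a∈D , refl))) ,
      target≡v′
  ... | no u∉D | no unmatched =
    colour 1F j , dominator j v , v ,
    edgeColour-arc (arcColour-spare (proj₂ (dominator-spec j uv) , refl , unmatched)) ,
    inj₂ (inj₂ (inj₂ refl)) , sameEdge-from-arcs (Spare j) spare-sound unique
    where
    unique : ∀ {a b} → Spare j a b → Incident u v a b → a ≡ dominator j v × b ≡ v
    unique (ab , refl , _) incident with arc-incident uv ab incident
    ... | inj₁ dominator≡u =
      contradiction (subst (_∈ dominators j) dominator≡u (proj₁ (dominator-spec j ab))) u∉D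
    ... | inj₂ refl       = refl , refl

  scfColouring : SCFColouring G (2 * L)
  scfColouring = colouring , λ u v uv → uniqueColour⇒satisfied colouring (oriented uv)
    where
    oriented : ∀ {u v} → adj G u v ≡ true → UniqueColour colouring u v
    oriented uv with arc-orientation uv
    ... | _ , inj₁ uv′ = uniqueColour-arc uv′
    ... | _ , inj₂ vu  = uniqueColour-flip colouring (uniqueColour-arc vu)

properColouring⇒scfColouring : ∀ G {χ} → ProperColouring G χ → SCFColouring G (2 * ⌈log₂ χ ⌉)
properColouring⇒scfColouring G {χ} (c , proper) = BinaryCode.scfColouring G ⌈log₂ χ ⌉ code code-proper
  where
  code : Fin (n G) → Vec (Fin 2) ⌈log₂ χ ⌉
  code x = binary ⌈log₂ χ ⌉ (inject≤ (c x) (n≤2^⌈log₂n⌉ χ))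

  code-proper : ∀ u v → adj G u v ≡ true → code u ≢ code v
  code-proper u v uv = proper u v uv ∘ inject≤-injective _ _ (c u) (c v) ∘ binary-injective ⌈log₂ χ ⌉

-- Isolated vertices lie on no edge.
theorem2 : (G : Graph) → NoIsolatedVertices G →
    ∀ (χ s : ℕ) → IsChromaticNumber G χ → IsSCFIndex G s →
    s ≤ 3 * ⌈log₂ χ ⌉
theorem2 G _ χ s (colourable , _) (_ , minimal) = begin
  s             ≤⟨ minimal _ (properColouring⇒scfColouring G colourable) ⟩
  2 * ⌈log₂ χ ⌉ ≤⟨ *-monoˡ-≤ ⌈log₂ χ ⌉ {2} {3} (s≤s (s≤s z≤n)) ⟩
  3 * ⌈log₂ χ ⌉ ∎
  where open ≤-Reasoning
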